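{- Let $r\geq 2$ and $k<n$ be positive integers and let $V$ be a $k$-dimensional $\mathbb{F}_q$-subspace of $\mathbb{F}_{q^n}$ such that $\dim_{\mathbb{F}_q}(V^r)=\binom{k+r-1}{r}$. Then $V$ is an $r$-Sidon space.
   Context: For an $\mathbb{F}_q$-subspace $V$ of $\mathbb{F}_{q^n}$, $V^r=\langle v_1\cdots v_r: v_i\in V\rangle_{\mathbb{F}_q}$. For integers $k<n$ and $r\geq 2$, a $k$-dimensional $\mathbb{F}_q$-subspace $V$ of $\mathbb{F}_{q^n}$ is an $r$-Sidon space if for all nonzero $a_1,\ldots,a_r,b_1,\ldots,b_r\in V$ with $\prod_{i=1}^r a_i=\prod_{i=1}^r b_i$, the multisets $\{\{a_1\mathbb{F}_q,\ldots,a_r\mathbb{F}_q\}\}$ and $\{\{b_1\mathbb{F}_q,\ldots,b_r\mathbb{F}_q\}\}$ coincide, where $e\mathbb{F}_q=\{e\lambda:\lambda\in\mathbb{F}_q\}$. -}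

module Defs where

open import Level using (0ℓ)
open import Data.Nat using (ℕ; zero; suc)
open import Data.Fin using (Fin; zero; suc)
open import Data.Fin.Permutation using (Permutation′; _⟨$⟩ʳ_)
open import Data.Product using (Σ; ∃; ∃-syntax; _×_; _,_)
open import Algebra.Bundles using (CommutativeRing)
open import Relation.Unary using (Pred)
open import Relation.Nullary using (¬_)
open import Relation.Binary.PropositionalEquality using (_≡_)
open import Function.Bundles using (_⇔_)

module FieldDefs (E : CommutativeRing 0ℓ 0ℓ) where
  open CommutativeRing E using (_≈_; _+_; _*_; -_; 0#; 1#) renaming (Carrier to C)

  record IsField : Set where
    field
      nontrivial : ¬ (1# ≈ 0#)
      inverse    : ∀ x → ¬ (x ≈ 0#) → ∃[ y ] (x * y ≈ 1#)

  record IsSubfield (K : Pred C 0ℓ) : Set where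
    field
      resp  : ∀ {x y} → x ≈ y → K x → K y
      zeroK : K 0#
      oneK  : K 1#
      addK  : ∀ {x y} → K x → K y → K (x + y)
      negK  : ∀ {x} → K x → K (- x)
      mulK  : ∀ {x y} → K x → K y → K (x * y)
      invK  : ∀ {x y} → K x → ¬ (x ≈ 0#) → x * y ≈ 1# → K y

  HasCard : Pred C 0ℓ → ℕ → Set
  HasCard K q = Σ (Fin q → C) λ e → ((∀ (i : Fin q) → K (e i))
                      × (∀ i j → e i ≈ e j → i ≡ j)
                      × (∀ x → K x → Σ (Fin q) λ i → (x ≈ e i)))

  record IsSubspace (K : Pred C 0ℓ) (V : Pred C 0ℓ) : Set where
    field
      resp  : ∀ {x y} → x ≈ y → V x → V y
      zeroV : V 0#
      addV  : ∀ {x y} → V x → V y → V (x + y)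
      smulV : ∀ {l x} → K l → V x → V (l * x)

  sumF : ∀ {m} → (Fin m → C) → C
  sumF {zero}  f = 0#
  sumF {suc m} f = f zero + sumF (λ i → f (suc i))

  prodF : ∀ {m} → (Fin m → C) → C
  prodF {zero}  f = 1#
  prodF {suc m} f = f zero * prodF (λ i → f (suc i))

  LinComb : (K : Pred C 0ℓ) → ∀ {m} → (Fin m → C) → C → Set
  LinComb K {m} v x = Σ (Fin m → C) λ c → ((∀ j → K (c j)) × (x ≈ sumF (λ j → c j * v j)))

  LinIndep : (K : Pred C 0ℓ) → ∀ {m} → (Fin m → C) → Set
  LinIndep K {m} v = ∀ (c : Fin m → C) → (∀ j → K (c j))
                   → sumF (λ j → c j * v j) ≈ 0# → ∀ j → c j ≈ 0#

  IsBasisOf : (K P : Pred C 0ℓ) → ∀ {m} → (Fin m → C) → Set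
  IsBasisOf K P v = (∀ j → P (v j)) × LinIndep K v × (∀ x → P x → LinComb K v x)

  HasDim : (K P : Pred C 0ℓ) → ℕ → Set
  HasDim K P d = Σ (Fin d → C) λ v → IsBasisOf K P {d} v

  Whole : Pred C 0ℓ
  Whole _ = 1# ≈ 1#

  -- V^r = K-span of { v₁ ⋯ v_r : vᵢ ∈ V }
  Pow : (K V : Pred C 0ℓ) → ℕ → Pred C 0ℓ
  Pow K V r x = Σ ℕ λ m → Σ (Fin m → C) λ c → Σ (Fin m → Fin r → C) λ a →
                  ((∀ (j : Fin m) → K (c j))
                 × (∀ j (i : Fin r) → V (a j i))
                 × (x ≈ sumF (λ j → c j * prodF (a j))))

  Line : Pred C 0ℓ → C → Pred C 0ℓ
  Line K e x = Σ C λ l → (K l × x ≈ e * l)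

  SameLine : Pred C 0ℓ → C → C → Set
  SameLine K a b = ∀ x → Line K a x ⇔ Line K b x

  -- r-Sidon space: equality of products of nonzero elements of V forces equality of the
  -- multisets {{a₁K,…,a_rK}} and {{b₁K,…,b_rK}} (a permutation matching equal lines)
  IsRSidon : (K V : Pred C 0ℓ) → ℕ → Set
  IsRSidon K V r = ∀ (a b : Fin r → C)
                 → (∀ i → V (a i) × ¬ (a i ≈ 0#))
                 → (∀ i → V (b i) × ¬ (b i ≈ 0#))
                 → prodF a ≈ prodF b
                 → Σ (Permutation′ r) λ σ → (∀ i → SameLine K (a i) (b (σ ⟨$⟩ʳ i)))

{-# OPTIONS --safe #-}
-- Extend a₁ to a basis s = (a₁, s₂, …, s_k) of V. The C(k+r-1, r) monomials of degree r in s span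
-- V^r, so the dimension hypothesis makes them linearly independent, and dividing by a₁ shows the same
-- in every lower degree. Write each bⱼ = βⱼ a₁ + ρⱼ with ρⱼ in the span of s₂, …, s_k. In
-- a₁ ∏ᵢ₌₂ aᵢ = γ ∏ bⱼ (γ ∈ K nonzero, carried along by the induction) the term γ ∏ ρⱼ involves only
-- monomials avoiding a₁ while everything else is divisible by a₁, so ∏ ρⱼ = 0: some bⱼ lies on the
-- line a₁K. Cancelling a₁ against bⱼ reduces r by one.
module Submission where

open import Defs
open import Level using (0ℓ)
open import Algebra.Bundles using (CommutativeRing)
open import Relation.Unary using (Pred)
open import Data.Nat using (ℕ; zero; suc; _≤_; _<_; z≤n; s≤s)
import Data.Nat.Properties as ℕ
open import Data.Nat.Combinatorics using (_C_; nCk≡nC[n∸k]; nCn≡1; k>n⇒nCk≡0; nCk+nC[k+1]≡[n+1]C[k+1])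
open import Data.Fin using (Fin; zero; suc; punchIn; punchOut; splitAt; _↑ˡ_; _↑ʳ_)
import Data.Fin.Properties as Fin
open import Data.Fin.Permutation using (Permutation′; _⟨$⟩ʳ_; insert; insert-punchIn) renaming (id to idₚ)
open import Data.Vec.Functional using (Vector; _∷_; _++_; head; tail; insertAt; removeAt)
open import Data.Vec.Functional.Properties using (lookup-++ˡ; lookup-++ʳ; insertAt-lookup; insertAt-punchIn)
open import Data.Product using (Σ; ∃-syntax; _×_; _,_; proj₁; proj₂)
open import Data.Sum using (inj₁; inj₂)
open import Data.Empty using (⊥-elim)
open import Relation.Nullary using (¬_; Dec; yes; no; ¬?)
import Relation.Binary.PropositionalEquality as ≡
open ≡ using (_≡_)
open import Function.Base using (_∘_)
open import Function.Bundles using (mk⇔)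

module _ where
  open import Data.Nat using (_+_; _∸_)

  multichoose : ℕ → ℕ → ℕ
  multichoose k       zero    = 1
  multichoose zero    (suc r) = 0
  multichoose (suc k) (suc r) = multichoose k (suc r) + multichoose (suc k) r

  multichoose≡binomial : ∀ k r → multichoose k r ≡ (k + r ∸ 1) C r
  multichoose≡binomial zero    zero    = ≡.refl
  multichoose≡binomial zero    (suc r) = ≡.sym (k>n⇒nCk≡0 (ℕ.n<1+n r))
  multichoose≡binomial (suc k) zero    = ≡.sym (≡.trans (nCk≡nC[n∸k] {k = 0} {n = k + 0} z≤n) (nCn≡1 (k + 0)))
  multichoose≡binomial (suc k) (suc r) = begin
    multichoose k (suc r) + multichoose (suc k) r
      ≡⟨ ≡.cong₂ _+_ (multichoose≡binomial k (suc r)) (multichoose≡binomial (suc k) r) ⟩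
    (k + suc r ∸ 1) C suc r + (k + r) C r         ≡⟨ ≡.cong (λ m → (m ∸ 1) C suc r + (k + r) C r) (ℕ.+-suc k r) ⟩
    (k + r) C suc r + (k + r) C r                 ≡⟨ ℕ.+-comm ((k + r) C suc r) _ ⟩
    (k + r) C r + (k + r) C suc r                 ≡⟨ nCk+nC[k+1]≡[n+1]C[k+1] (k + r) r ⟩
    suc (k + r) C suc r                           ≡⟨ ≡.cong (_C suc r) (ℕ.+-suc k r) ⟨
    (k + suc r) C suc r                           ∎
    where open ≡.≡-Reasoning

module _ {A : Set} (P : A → Set) where

  ++-all : ∀ {m p} {xs : Vector A m} {ys : Vector A p} →
           (∀ i → P (xs i)) → (∀ i → P (ys i)) → ∀ j → P ((xs ++ ys) j)
  ++-all {m} Pxs Pys j with splitAt m j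
  ... | inj₁ i = Pxs i
  ... | inj₂ i = Pys i

  insertAt-all : ∀ {m} {xs : Vector A m} (i : Fin (suc m)) {v : A} →
                 (∀ t → P (xs t)) → P v → ∀ j → P (insertAt xs i v j)
  insertAt-all {xs = xs} i {v} Pxs Pv j with i Fin.≟ j
  ... | yes ≡.refl = ≡.subst P (≡.sym (insertAt-lookup xs i v)) Pv
  ... | no i≢j     = ≡.subst P (≡.trans (≡.sym (insertAt-punchIn xs i v (punchOut i≢j)))
                                        (≡.cong (insertAt xs i v) (Fin.punchIn-punchOut i≢j)))
                              (Pxs (punchOut i≢j))

tail-++ : ∀ {A : Set} {m p} (xs : Vector A (suc m)) (ys : Vector A p) i →
          tail (xs ++ ys) i ≡ (tail xs ++ ys) i
tail-++ {m = m} xs ys i with splitAt m i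
... | inj₁ _ = ≡.refl
... | inj₂ _ = ≡.refl

module FieldArithmetic (E : CommutativeRing 0ℓ 0ℓ) (isField : FieldDefs.IsField E) where
  open CommutativeRing E hiding (zero) renaming (Carrier to F)
  open FieldDefs E
  open IsField isField
  open import Algebra.Properties.Semiring.Sum semiring
    using (sum; sum-cong-≋; sum-remove; ∑-distrib-+; *-distribˡ-sum; *-distribʳ-sum; sum-replicate-zero)
  open import Algebra.Properties.CommutativeMonoid.Sum *-commutativeMonoid as Π using ()
  open import Relation.Binary.Reasoning.Setoid setoid
  open import Algebra.Solver.Ring.NaturalCoefficients.Default commutativeSemiring

  sumF≡sum : ∀ {m} (f : Vector F m) → sumF f ≡ sum f
  sumF≡sum {zero}  f = ≡.refl
  sumF≡sum {suc m} f = ≡.cong (f zero +_) (sumF≡sum (tail f))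

  prodF≡product : ∀ {m} (f : Vector F m) → prodF f ≡ Π.sum f
  prodF≡product {zero}  f = ≡.refl
  prodF≡product {suc m} f = ≡.cong (f zero *_) (prodF≡product (tail f))

  sumF-cong : ∀ {m} {f g : Vector F m} → (∀ i → f i ≈ g i) → sumF f ≈ sumF g
  sumF-cong {f = f} {g} f≈g rewrite sumF≡sum f | sumF≡sum g = sum-cong-≋ f≈g

  sumF-zero : ∀ {m} {f : Vector F m} → (∀ i → f i ≈ 0#) → sumF f ≈ 0#
  sumF-zero {m} f≈0 = trans (sumF-cong f≈0) (≡.subst (_≈ 0#) (≡.sym (sumF≡sum {m} (λ _ → 0#))) (sum-replicate-zero m))

  sumF-remove : ∀ {m} (f : Vector F (suc m)) i → sumF f ≈ f i + sumF (removeAt f i)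
  sumF-remove f i rewrite sumF≡sum f | sumF≡sum (removeAt f i) = sum-remove f

  prodF-remove : ∀ {m} (f : Vector F (suc m)) i → prodF f ≈ f i * prodF (removeAt f i)
  prodF-remove f i rewrite prodF≡product f | prodF≡product (removeAt f i) = Π.sum-remove f

  sumF-+ : ∀ {m} (f g : Vector F m) → sumF (λ i → f i + g i) ≈ sumF f + sumF g
  sumF-+ f g rewrite sumF≡sum (λ i → f i + g i) | sumF≡sum f | sumF≡sum g = ∑-distrib-+ f g

  *-distribˡ-sumF : ∀ {m} x (f : Vector F m) → x * sumF f ≈ sumF (λ i → x * f i)
  *-distribˡ-sumF x f rewrite sumF≡sum f | sumF≡sum (λ i → x * f i) = *-distribˡ-sum x f

  *-distribʳ-sumF : ∀ {m} x (f : Vector F m) → sumF f * x ≈ sumF (λ i → f i * x)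
  *-distribʳ-sumF x f rewrite sumF≡sum f | sumF≡sum (λ i → f i * x) = *-distribʳ-sum x f

  sumF-++ : ∀ {m p} (f : Vector F m) (g : Vector F p) → sumF (f ++ g) ≈ sumF f + sumF g
  sumF-++ {zero}  f g = sym (+-identityˡ _)
  sumF-++ {suc m} f g = begin
    f zero + sumF (tail (f ++ g))   ≈⟨ +-congˡ (sumF-cong (λ i → reflexive (tail-++ f g i))) ⟩
    f zero + sumF (tail f ++ g)     ≈⟨ +-congˡ (sumF-++ (tail f) g) ⟩
    f zero + (sumF (tail f) + sumF g) ≈⟨ +-assoc _ _ _ ⟨
    sumF f + sumF g                 ∎

  inv : (x : F) → ¬ x ≈ 0# → F
  inv x x≉0 = proj₁ (inverse x x≉0)

  inv-inverseʳ : ∀ {x} (x≉0 : ¬ x ≈ 0#) → x * inv x x≉0 ≈ 1#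
  inv-inverseʳ {x} x≉0 = proj₂ (inverse x x≉0)

  inv-inverseˡ : ∀ {x} (x≉0 : ¬ x ≈ 0#) → inv x x≉0 * x ≈ 1#
  inv-inverseˡ x≉0 = trans (*-comm _ _) (inv-inverseʳ x≉0)

  *-cancelˡ : ∀ {a x y} → ¬ a ≈ 0# → a * x ≈ a * y → x ≈ y
  *-cancelˡ {a} {x} {y} a≉0 ax≈ay = begin
    x                  ≈⟨ *-identityˡ x ⟨
    1# * x             ≈⟨ *-congʳ (inv-inverseˡ a≉0) ⟨
    (inv a a≉0 * a) * x ≈⟨ *-assoc _ _ _ ⟩
    inv a a≉0 * (a * x) ≈⟨ *-congˡ ax≈ay ⟩
    inv a a≉0 * (a * y) ≈⟨ *-assoc _ _ _ ⟨
    (inv a a≉0 * a) * y ≈⟨ *-congʳ (inv-inverseˡ a≉0) ⟩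
    1# * y             ≈⟨ *-identityˡ y ⟩
    y                  ∎

  *-≉0 : ∀ {x y} → ¬ x ≈ 0# → ¬ y ≈ 0# → ¬ x * y ≈ 0#
  *-≉0 {x} x≉0 y≉0 xy≈0 = y≉0 (*-cancelˡ x≉0 (trans xy≈0 (sym (zeroʳ x))))

  prodF-cancelHead : ∀ {r γ β} (a b : Vector F (suc r)) j → ¬ a zero ≈ 0# → b j ≈ β * a zero →
                     prodF a ≈ γ * prodF b → prodF (tail a) ≈ (γ * β) * prodF (removeAt b j)
  prodF-cancelHead {γ = γ} {β} a b j a₀≉0 bⱼ≈βa₀ Πa≈γΠb = *-cancelˡ a₀≉0 (begin
    a zero * prodF (tail a)                     ≈⟨ Πa≈γΠb ⟩
    γ * prodF b                                 ≈⟨ *-congˡ (prodF-remove b j) ⟩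
    γ * (b j * prodF (removeAt b j))            ≈⟨ *-congˡ (*-congʳ bⱼ≈βa₀) ⟩
    γ * ((β * a zero) * prodF (removeAt b j))
      ≈⟨ solve 4 (λ γ β a₀ Π → γ :* ((β :* a₀) :* Π) := a₀ :* ((γ :* β) :* Π))
               refl γ β (a zero) (prodF (removeAt b j)) ⟩
    a zero * ((γ * β) * prodF (removeAt b j))   ∎)

module Span (E : CommutativeRing 0ℓ 0ℓ) (isField : FieldDefs.IsField E)
            (K : Pred (CommutativeRing.Carrier E) 0ℓ) (isSubfield : FieldDefs.IsSubfield E K) where
  open CommutativeRing E hiding (zero) renaming (Carrier to F)
  open FieldDefs E
  open FieldArithmetic E isField public
  module Sub = IsSubfield isSubfield
  open import Relation.Binary.Reasoning.Setoid setoid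
  open import Algebra.Properties.Ring ring using (-1*x≈-x; -‿distribˡ-*)
  open import Algebra.Properties.CommutativeSemigroup *-commutativeSemigroup using (x∙yz≈y∙xz)
  open import Algebra.Solver.Ring.NaturalCoefficients.Default commutativeSemiring

  infix 4 _∈⟨_⟩
  record _∈⟨_⟩ {m} (x : F) (u : Vector F m) : Set where
    constructor combination
    field
      coeffs   : Vector F m
      K-coeffs : ∀ i → K (coeffs i)
      expand   : x ≈ sumF (λ i → coeffs i * u i)

  LinComb⇒∈⟨⟩ : ∀ {m x} {u : Vector F m} → LinComb K u x → x ∈⟨ u ⟩
  LinComb⇒∈⟨⟩ (c , Kc , x≈Σ) = combination c Kc x≈Σ

  module _ {m} {u : Vector F m} where

    ∈⟨⟩-resp : ∀ {x y} → x ≈ y → x ∈⟨ u ⟩ → y ∈⟨ u ⟩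
    ∈⟨⟩-resp x≈y (combination c Kc x≈Σ) = combination c Kc (trans (sym x≈y) x≈Σ)

    0∈⟨⟩ : 0# ∈⟨ u ⟩
    0∈⟨⟩ = combination (λ _ → 0#) (λ _ → Sub.zeroK) (sym (sumF-zero (λ i → zeroˡ (u i))))

    +-∈⟨⟩ : ∀ {x y} → x ∈⟨ u ⟩ → y ∈⟨ u ⟩ → x + y ∈⟨ u ⟩
    +-∈⟨⟩ {x} {y} (combination c Kc x≈Σ) (combination d Kd y≈Σ) =
      combination (λ i → c i + d i) (λ i → Sub.addK (Kc i) (Kd i)) (begin
      x + y                                         ≈⟨ +-cong x≈Σ y≈Σ ⟩
      sumF (λ i → c i * u i) + sumF (λ i → d i * u i) ≈⟨ sumF-+ (λ i → c i * u i) (λ i → d i * u i) ⟨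
      sumF (λ i → c i * u i + d i * u i)            ≈⟨ sumF-cong (λ i → distribʳ (u i) (c i) (d i)) ⟨
      sumF (λ i → (c i + d i) * u i)                ∎)

    *-∈⟨⟩ : ∀ {l x} → K l → x ∈⟨ u ⟩ → l * x ∈⟨ u ⟩
    *-∈⟨⟩ {l} {x} Kl (combination c Kc x≈Σ) = combination (λ i → l * c i) (λ i → Sub.mulK Kl (Kc i)) (begin
      l * x                          ≈⟨ *-congˡ x≈Σ ⟩
      l * sumF (λ i → c i * u i)     ≈⟨ *-distribˡ-sumF l (λ i → c i * u i) ⟩
      sumF (λ i → l * (c i * u i))   ≈⟨ sumF-cong (λ i → *-assoc l (c i) (u i)) ⟨
      sumF (λ i → (l * c i) * u i)   ∎)

    -‿∈⟨⟩ : ∀ {x} → x ∈⟨ u ⟩ → - x ∈⟨ u ⟩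
    -‿∈⟨⟩ x∈ = ∈⟨⟩-resp (-1*x≈-x _) (*-∈⟨⟩ (Sub.negK Sub.oneK) x∈)

    sumF-∈⟨⟩ : ∀ {p} (f : Vector F p) → (∀ i → f i ∈⟨ u ⟩) → sumF f ∈⟨ u ⟩
    sumF-∈⟨⟩ {zero}  f f∈ = 0∈⟨⟩
    sumF-∈⟨⟩ {suc p} f f∈ = +-∈⟨⟩ (f∈ zero) (sumF-∈⟨⟩ (tail f) (f∈ ∘ suc))

  unitVector : ∀ {m} → Fin m → Vector F m
  unitVector {suc m} i = insertAt (λ _ → 0#) i 1#

  K-unitVector : ∀ {m} (i j : Fin m) → K (unitVector i j)
  K-unitVector {suc m} i = insertAt-all K i (λ _ → Sub.zeroK) Sub.oneK

  unitVector-diagonal : ∀ {m} (i : Fin m) → unitVector i i ≈ 1#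
  unitVector-diagonal {suc m} i = reflexive (insertAt-lookup _ i 1#)

  sumF-unitVector : ∀ {m} (u : Vector F m) i → sumF (λ j → unitVector i j * u j) ≈ u i
  sumF-unitVector {suc m} u i = begin
    sumF (λ j → unitVector i j * u j)                           ≈⟨ sumF-remove (λ j → unitVector i j * u j) i ⟩
    unitVector i i * u i + sumF (removeAt (λ j → unitVector i j * u j) i)
      ≈⟨ +-cong (*-congʳ (unitVector-diagonal i)) (sumF-zero off-diagonal) ⟩
    1# * u i + 0#                                               ≈⟨ trans (+-identityʳ _) (*-identityˡ _) ⟩
    u i                                                         ∎
    where
    off-diagonal : ∀ t → unitVector i (punchIn i t) * u (punchIn i t) ≈ 0#
    off-diagonal t = trans (*-congʳ (reflexive (insertAt-punchIn _ i 1# t))) (zeroˡ _)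

  module _ {m} {u : Vector F m} where

    generator-∈⟨⟩ : ∀ i → u i ∈⟨ u ⟩
    generator-∈⟨⟩ i = combination (unitVector i) (K-unitVector i) (sym (sumF-unitVector u i))

    LinIndep⇒≉0 : LinIndep K u → ∀ i → ¬ u i ≈ 0#
    LinIndep⇒≉0 indep i uᵢ≈0 = IsField.nontrivial isField
      (trans (sym (unitVector-diagonal i))
             (indep (unitVector i) (K-unitVector i) (trans (sumF-unitVector u i) uᵢ≈0) i))

    ∈⟨⟩-mono : ∀ {p} {v : Vector F p} → (∀ i → u i ∈⟨ v ⟩) → ∀ {x} → x ∈⟨ u ⟩ → x ∈⟨ v ⟩
    ∈⟨⟩-mono u⊆v (combination c Kc x≈Σ) = ∈⟨⟩-resp (sym x≈Σ) (sumF-∈⟨⟩ _ (λ i → *-∈⟨⟩ (Kc i) (u⊆v i)))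

    *-∈⟨*⟩ : ∀ a {x} → x ∈⟨ u ⟩ → a * x ∈⟨ (a *_) ∘ u ⟩
    *-∈⟨*⟩ a {x} (combination c Kc x≈Σ) = combination c Kc (begin
      a * x                          ≈⟨ *-congˡ x≈Σ ⟩
      a * sumF (λ i → c i * u i)     ≈⟨ *-distribˡ-sumF a (λ i → c i * u i) ⟩
      sumF (λ i → a * (c i * u i))   ≈⟨ sumF-cong (λ i → x∙yz≈y∙xz a (c i) (u i)) ⟩
      sumF (λ i → c i * (a * u i))   ∎)

  ∈⟨++ˡ⟩ : ∀ {m p x} {u : Vector F m} (v : Vector F p) → x ∈⟨ u ⟩ → x ∈⟨ u ++ v ⟩
  ∈⟨++ˡ⟩ {p = p} {u = u} v =
    ∈⟨⟩-mono (λ i → ≡.subst (_∈⟨ u ++ v ⟩) (lookup-++ˡ u v i) (generator-∈⟨⟩ (i ↑ˡ p)))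

  ∈⟨++ʳ⟩ : ∀ {m p x} (u : Vector F m) {v : Vector F p} → x ∈⟨ v ⟩ → x ∈⟨ u ++ v ⟩
  ∈⟨++ʳ⟩ {m} u {v} =
    ∈⟨⟩-mono (λ i → ≡.subst (_∈⟨ u ++ v ⟩) (lookup-++ʳ u v i) (generator-∈⟨⟩ (m ↑ʳ i)))

  *-∈⟨⟩-bilinear : ∀ {m p t} {u : Vector F m} {v : Vector F p} {w : Vector F t} →
                   (∀ i j → u i * v j ∈⟨ w ⟩) → ∀ {x y} → x ∈⟨ u ⟩ → y ∈⟨ v ⟩ → x * y ∈⟨ w ⟩
  *-∈⟨⟩-bilinear {u = u} {v} {w} uv⊆w {x} x∈ y∈ = ∈⟨⟩-mono (λ j → xvⱼ∈ j) (*-∈⟨*⟩ x y∈)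
    where
    xvⱼ∈ : ∀ j → x * v j ∈⟨ w ⟩
    xvⱼ∈ j = ∈⟨⟩-resp (*-comm _ _)
               (∈⟨⟩-mono (λ i → ∈⟨⟩-resp (*-comm _ _) (uv⊆w i j)) (*-∈⟨*⟩ (v j) x∈))

  module _ {m p} {u : Vector F m} {v : Vector F p} (indep : LinIndep K (u ++ v)) where

    LinIndep-++ : ∀ (c : Vector F m) (d : Vector F p) → (∀ i → K (c i)) → (∀ i → K (d i)) →
                  sumF (λ i → c i * u i) + sumF (λ i → d i * v i) ≈ 0# →
                  (∀ i → c i ≈ 0#) × (∀ i → d i ≈ 0#)
    LinIndep-++ c d Kc Kd Σ≈0 = (λ i → ≡.subst (_≈ 0#) (lookup-++ˡ c d i) (cd≈0 (i ↑ˡ p)))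
                              , (λ i → ≡.subst (_≈ 0#) (lookup-++ʳ c d i) (cd≈0 (m ↑ʳ i)))
      where
      zip-++ : ∀ j → (c ++ d) j * (u ++ v) j ≡ ((λ i → c i * u i) ++ (λ i → d i * v i)) j
      zip-++ j with splitAt m j
      ... | inj₁ _ = ≡.refl
      ... | inj₂ _ = ≡.refl

      cd≈0 : ∀ j → (c ++ d) j ≈ 0#
      cd≈0 = indep (c ++ d) (++-all K Kc Kd) (begin
        sumF (λ j → (c ++ d) j * (u ++ v) j)                     ≈⟨ sumF-cong (reflexive ∘ zip-++) ⟩
        sumF ((λ i → c i * u i) ++ (λ i → d i * v i))            ≈⟨ sumF-++ (λ i → c i * u i) (λ i → d i * v i) ⟩
        sumF (λ i → c i * u i) + sumF (λ i → d i * v i)          ≈⟨ Σ≈0 ⟩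
        0#                                                       ∎)

    LinIndep-++ʳ : LinIndep K v
    LinIndep-++ʳ d Kd Σ≈0 = proj₂ (LinIndep-++ (λ _ → 0#) d (λ _ → Sub.zeroK) Kd
      (trans (+-congʳ (sumF-zero (λ i → zeroˡ (u i)))) (trans (+-identityˡ _) Σ≈0)))

    LinIndep-++⇒≈0 : ∀ {x y} → x ∈⟨ u ⟩ → y ∈⟨ v ⟩ → x + y ≈ 0# → x ≈ 0#
    LinIndep-++⇒≈0 {x} (combination c Kc x≈Σ) (combination d Kd y≈Σ) x+y≈0 = begin
      x                       ≈⟨ x≈Σ ⟩
      sumF (λ i → c i * u i)  ≈⟨ sumF-zero (λ i → trans (*-congʳ (c≈0 i)) (zeroˡ _)) ⟩
      0#                      ∎
      where
      c≈0 : ∀ i → c i ≈ 0#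
      c≈0 = proj₁ (LinIndep-++ c d Kc Kd (trans (+-cong (sym x≈Σ) (sym y≈Σ)) x+y≈0))

  LinIndep-*⁻¹ : ∀ {m} {u : Vector F m} a → LinIndep K ((a *_) ∘ u) → LinIndep K u
  LinIndep-*⁻¹ {u = u} a indep c Kc Σ≈0 = indep c Kc (begin
    sumF (λ i → c i * (a * u i))  ≈⟨ sumF-cong (λ i → x∙yz≈y∙xz (c i) a (u i)) ⟩
    sumF (λ i → a * (c i * u i))  ≈⟨ *-distribˡ-sumF a (λ i → c i * u i) ⟨
    a * sumF (λ i → c i * u i)    ≈⟨ *-congˡ Σ≈0 ⟩
    a * 0#                        ≈⟨ zeroʳ a ⟩
    0#                            ∎)

  K-sumF : ∀ {m} (f : Vector F m) → (∀ i → K (f i)) → K (sumF f)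
  K-sumF {zero}  f Kf = Sub.zeroK
  K-sumF {suc m} f Kf = Sub.addK (Kf zero) (K-sumF (tail f) (Kf ∘ suc))

  LinIndep-shear : ∀ {m} {w : Vector F (suc m)} → LinIndep K w →
                   ∀ i (g : Vector F m) → (∀ t → K (g t)) →
                   LinIndep K (λ t → w (punchIn i t) + g t * w i)
  LinIndep-shear {m} {w} indep i g Kg c Kc Σ≈0 t =
    ≡.subst (_≈ 0#) (insertAt-punchIn c i D t) (d≈0 (punchIn i t))
    where
    D : F
    D = sumF (λ t → c t * g t)
    d : Vector F (suc m)
    d = insertAt c i D
    d≈0 : ∀ j → d j ≈ 0#
    d≈0 = indep d (insertAt-all K i Kc (K-sumF _ (λ t → Sub.mulK (Kc t) (Kg t)))) (begin
      sumF (λ j → d j * w j)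
        ≈⟨ sumF-remove (λ j → d j * w j) i ⟩
      d i * w i + sumF (λ t → d (punchIn i t) * w (punchIn i t))
        ≈⟨ +-cong (*-congʳ (reflexive (insertAt-lookup c i D)))
                  (sumF-cong (λ t → *-congʳ (reflexive (insertAt-punchIn c i D t)))) ⟩
      D * w i + sumF (λ t → c t * w (punchIn i t))
        ≈⟨ +-comm _ _ ⟩
      sumF (λ t → c t * w (punchIn i t)) + D * w i
        ≈⟨ +-congˡ (*-distribʳ-sumF (w i) (λ t → c t * g t)) ⟩
      sumF (λ t → c t * w (punchIn i t)) + sumF (λ t → (c t * g t) * w i)
        ≈⟨ sumF-+ (λ t → c t * w (punchIn i t)) (λ t → (c t * g t) * w i) ⟨
      sumF (λ t → c t * w (punchIn i t) + (c t * g t) * w i)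
        ≈⟨ sumF-cong {m} (λ t → trans (+-congˡ (*-assoc _ _ _)) (sym (distribˡ _ _ _))) ⟩
      sumF (λ t → c t * (w (punchIn i t) + g t * w i))
        ≈⟨ Σ≈0 ⟩
      0# ∎)

  record HeadSplit {m} (u : Vector F (suc m)) (x : F) : Set where
    field
      coeff   : F
      K-coeff : K coeff
      rest    : F
      rest∈   : rest ∈⟨ tail u ⟩
      split   : x ≈ coeff * head u + rest

  headSplit : ∀ {m x} {u : Vector F (suc m)} → x ∈⟨ u ⟩ → HeadSplit u x
  headSplit (combination c Kc x≈Σ) = record
    { coeff = c zero ; K-coeff = Kc zero ; rest = _ ; rest∈ = combination (tail c) (Kc ∘ suc) refl ; split = x≈Σ }

  eliminateHead : ∀ {m x y} {u : Vector F (suc m)} (hx : HeadSplit u x) (hy : HeadSplit u y) →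
                  (b≉0 : ¬ HeadSplit.coeff hy ≈ 0#) →
                  let g = - (HeadSplit.coeff hx * inv (HeadSplit.coeff hy) b≉0) in
                  K g × x + g * y ∈⟨ tail u ⟩
  eliminateHead {x = x} {y} {u} hx hy b≉0 = Kg , ∈⟨⟩-resp (sym x+gy≈) (+-∈⟨⟩ X.rest∈ (*-∈⟨⟩ Kg Y.rest∈))
    where
    module X = HeadSplit hx
    module Y = HeadSplit hy
    b⁻¹ : F
    b⁻¹ = inv Y.coeff b≉0
    g : F
    g = - (X.coeff * b⁻¹)
    Kg : K g
    Kg = Sub.negK (Sub.mulK X.K-coeff (Sub.invK Y.K-coeff b≉0 (inv-inverseʳ b≉0)))
    a+gb≈0 : X.coeff + g * Y.coeff ≈ 0#
    a+gb≈0 = begin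
      X.coeff + g * Y.coeff                 ≈⟨ +-congˡ (-‿distribˡ-* _ _) ⟨
      X.coeff + - (X.coeff * b⁻¹ * Y.coeff) ≈⟨ +-congˡ (-‿cong (*-assoc _ _ _)) ⟩
      X.coeff + - (X.coeff * (b⁻¹ * Y.coeff)) ≈⟨ +-congˡ (-‿cong (trans (*-congˡ (inv-inverseˡ b≉0)) (*-identityʳ _))) ⟩
      X.coeff + - X.coeff                   ≈⟨ -‿inverseʳ _ ⟩
      0#                                    ∎
    x+gy≈ : x + g * y ≈ X.rest + g * Y.rest
    x+gy≈ = begin
      x + g * y
        ≈⟨ +-cong X.split (*-congˡ Y.split) ⟩
      (X.coeff * head u + X.rest) + g * (Y.coeff * head u + Y.rest)
        ≈⟨ solve 6 (λ a w x′ g b y′ → (a :* w :+ x′) :+ g :* (b :* w :+ y′)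
                                    := (a :+ g :* b) :* w :+ (x′ :+ g :* y′))
                 refl X.coeff (head u) X.rest g Y.coeff Y.rest ⟩
      (X.coeff + g * Y.coeff) * head u + (X.rest + g * Y.rest)
        ≈⟨ +-congʳ (trans (*-congʳ a+gb≈0) (zeroˡ _)) ⟩
      0# + (X.rest + g * Y.rest)
        ≈⟨ +-identityˡ _ ⟩
      X.rest + g * Y.rest
        ∎

  SameLine-* : ∀ {x y β} → K β → ¬ β ≈ 0# → y ≈ β * x → SameLine K x y
  SameLine-* {x} {y} {β} Kβ β≉0 y≈βx z = mk⇔ to from
    where
    β⁻¹ : F
    β⁻¹ = inv β β≉0
    to : Line K x z → Line K y z
    to (l , Kl , z≈xl) = β⁻¹ * l , Sub.mulK (Sub.invK Kβ β≉0 (inv-inverseʳ β≉0)) Kl , (begin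
      z                   ≈⟨ z≈xl ⟩
      x * l               ≈⟨ *-identityˡ _ ⟨
      1# * (x * l)        ≈⟨ *-congʳ (inv-inverseʳ β≉0) ⟨
      (β * β⁻¹) * (x * l)
        ≈⟨ solve 4 (λ b b⁻¹ x l → (b :* b⁻¹) :* (x :* l) := (b :* x) :* (b⁻¹ :* l)) refl β β⁻¹ x l ⟩
      (β * x) * (β⁻¹ * l) ≈⟨ *-congʳ y≈βx ⟨
      y * (β⁻¹ * l)       ∎)
    from : Line K y z → Line K x z
    from (l , Kl , z≈yl) = β * l , Sub.mulK Kβ Kl , (begin
      z             ≈⟨ z≈yl ⟩
      y * l         ≈⟨ *-congʳ y≈βx ⟩
      (β * x) * l   ≈⟨ solve 3 (λ b x l → (b :* x) :* l := x :* (b :* l)) refl β x l ⟩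
      x * (β * l)   ∎)

  K-≈0-dec : ∀ {q} → HasCard K q → ∀ x → K x → Dec (x ≈ 0#)
  K-≈0-dec (_ , _ , e-injective , e-surjective) x Kx
    with e-surjective 0# Sub.zeroK | e-surjective x Kx
  ... | i₀ , 0≈eᵢ₀ | i , x≈eᵢ with i Fin.≟ i₀
  ...   | yes ≡.refl = yes (trans x≈eᵢ (sym 0≈eᵢ₀))
  ...   | no i≢i₀    = no (λ x≈0 → i≢i₀ (e-injective i i₀ (trans (sym x≈eᵢ) (trans x≈0 0≈eᵢ₀))))

  -- The case splits on x ≈ 0 need this constructively; it is the only use of the finiteness of K and of E over K.
  ≈0-dec : ∀ {q n} → HasCard K q → HasDim K Whole n → ∀ x → Dec (x ≈ 0#)
  ≈0-dec card (_ , _ , indep , spanning) x with spanning x refl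
  ... | c , Kc , x≈Σ with Fin.all? (λ j → K-≈0-dec card (c j) (Kc j))
  ...   | yes c≈0 = yes (trans x≈Σ (sumF-zero (λ j → trans (*-congʳ (c≈0 j)) (zeroˡ _))))
  ...   | no c≉0  = no (λ x≈0 → c≉0 (indep c Kc (trans (sym x≈Σ) x≈0)))

module Dimension (E : CommutativeRing 0ℓ 0ℓ) (isField : FieldDefs.IsField E)
                 (K : Pred (CommutativeRing.Carrier E) 0ℓ) (isSubfield : FieldDefs.IsSubfield E K)
                 (_≟0 : ∀ x → Dec (CommutativeRing._≈_ E x (CommutativeRing.0# E))) where
  open CommutativeRing E hiding (zero) renaming (Carrier to F)
  open FieldDefs E
  open Span E isField K isSubfield public
  open import Relation.Binary.Reasoning.Setoid setoid
  open import Algebra.Properties.Ring ring using (x≈z//y)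

  someNonzero? : ∀ {m} (f : Vector F m) → Dec (∃[ i ] ¬ f i ≈ 0#)
  someNonzero? f = Fin.any? (λ i → ¬? (f i ≟0))

  allZero : ∀ {m} {f : Vector F m} → ¬ (∃[ i ] ¬ f i ≈ 0#) → ∀ i → f i ≈ 0#
  allZero {f = f} none i with f i ≟0
  ... | yes fᵢ≈0 = fᵢ≈0
  ... | no fᵢ≉0  = ⊥-elim (none (i , fᵢ≉0))

  prodF≈0⇒ : ∀ {m} (f : Vector F m) → prodF f ≈ 0# → ∃[ j ] f j ≈ 0#
  prodF≈0⇒ {zero}  f 1≈0 = ⊥-elim (IsField.nontrivial isField 1≈0)
  prodF≈0⇒ {suc m} f Π≈0 with f zero ≟0 | prodF (tail f) ≟0
  ... | yes f₀≈0 | _        = zero , f₀≈0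
  ... | no _     | yes Π′≈0 = let j , fⱼ≈0 = prodF≈0⇒ (tail f) Π′≈0 in suc j , fⱼ≈0
  ... | no f₀≉0  | no Π′≉0  = ⊥-elim (*-≉0 f₀≉0 Π′≉0 Π≈0)

  -- If some wᵢ has a nonzero u₀-coordinate, subtracting multiples of wᵢ from the others removes u₀
  -- and keeps them independent.
  LinIndep-∈⟨⟩⇒≤ : ∀ {m p} {w : Vector F m} {u : Vector F p} →
                   LinIndep K w → (∀ i → w i ∈⟨ u ⟩) → m ≤ p
  LinIndep-∈⟨⟩⇒≤ {zero}  {_}     _     _  = z≤n
  LinIndep-∈⟨⟩⇒≤ {suc m} {zero}  {w} indep w∈ =
    ⊥-elim (LinIndep⇒≉0 {u = w} indep zero (_∈⟨_⟩.expand (w∈ zero)))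
  LinIndep-∈⟨⟩⇒≤ {suc m} {suc p} {w} {u} indep w∈ = byPivot (someNonzero? W.coeff)
    where
    module W (i : Fin (suc m)) = HeadSplit (headSplit (w∈ i))
    byPivot : Dec (∃[ i ] ¬ W.coeff i ≈ 0#) → suc m ≤ suc p
    byPivot (no none) =
      ℕ.m≤n⇒m≤1+n (LinIndep-∈⟨⟩⇒≤ indep (λ i → ∈⟨⟩-resp (sym (wᵢ≈rest i)) (W.rest∈ i)))
      where
      wᵢ≈rest : ∀ i → w i ≈ W.rest i
      wᵢ≈rest i = trans (W.split i) (trans (+-congʳ (trans (*-congʳ (allZero none i)) (zeroˡ _))) (+-identityˡ _))
    byPivot (yes (i , bᵢ≉0)) =
      s≤s (LinIndep-∈⟨⟩⇒≤ (LinIndep-shear {w = w} indep i g (proj₁ ∘ elim)) (proj₂ ∘ elim))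
      where
      g : Vector F m
      g t = - (W.coeff (punchIn i t) * inv (W.coeff i) bᵢ≉0)
      elim : ∀ t → K (g t) × w (punchIn i t) + g t * w i ∈⟨ tail u ⟩
      elim t = eliminateHead (headSplit (w∈ (punchIn i t))) (headSplit (w∈ i)) bᵢ≉0

  ∈⟨⟩-exchange : ∀ {m p x} {u : Vector F (suc m)} {v : Vector F p} (c : Vector F (suc m)) →
                 (∀ i → K (c i)) → x ≈ sumF (λ i → c i * u i) → ∀ {j} → ¬ c j ≈ 0# →
                 x ∈⟨ v ⟩ → (∀ t → removeAt u j t ∈⟨ v ⟩) → ∀ i → u i ∈⟨ v ⟩
  ∈⟨⟩-exchange {x = x} {u} {v} c Kc x≈Σ {j} cⱼ≉0 x∈ others∈ i with j Fin.≟ i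
  ... | no j≢i     = ≡.subst (λ i → u i ∈⟨ v ⟩) (Fin.punchIn-punchOut j≢i) (others∈ (punchOut j≢i))
  ... | yes ≡.refl =
    ∈⟨⟩-resp (sym uⱼ≈) (*-∈⟨⟩ (Sub.invK (Kc j) cⱼ≉0 (inv-inverseʳ cⱼ≉0)) (+-∈⟨⟩ x∈ (-‿∈⟨⟩ T∈)))
    where
    T : F
    T = sumF (removeAt (λ i → c i * u i) j)
    T∈ : T ∈⟨ v ⟩
    T∈ = sumF-∈⟨⟩ _ (λ t → *-∈⟨⟩ (Kc (punchIn j t)) (others∈ t))
    uⱼ≈ : u j ≈ inv (c j) cⱼ≉0 * (x + - T)
    uⱼ≈ = *-cancelˡ cⱼ≉0 (begin
      c j * u j                          ≈⟨ x≈z//y (c j * u j) T x (sym (trans x≈Σ (sumF-remove (λ i → c i * u i) j))) ⟩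
      x + - T                            ≈⟨ *-identityˡ _ ⟨
      1# * (x + - T)                     ≈⟨ *-congʳ (inv-inverseʳ cⱼ≉0) ⟨
      (c j * inv (c j) cⱼ≉0) * (x + - T) ≈⟨ *-assoc _ _ _ ⟩
      c j * (inv (c j) cⱼ≉0 * (x + - T)) ∎)

  LinIndep-spanning : ∀ {N} {b S : Vector F N} → LinIndep K b → (∀ i → b i ∈⟨ S ⟩) → LinIndep K S
  LinIndep-spanning {suc N} {b} {S} indep b∈ c Kc Σ≈0 j with c j ≟0
  ... | yes cⱼ≈0 = cⱼ≈0
  ... | no cⱼ≉0  = ⊥-elim (ℕ.n≮n N (LinIndep-∈⟨⟩⇒≤ indep (λ i → ∈⟨⟩-mono S⊆ (b∈ i))))
    where
    S⊆ : ∀ i → S i ∈⟨ removeAt S j ⟩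
    S⊆ = ∈⟨⟩-exchange c Kc (sym Σ≈0) cⱼ≉0 0∈⟨⟩ generator-∈⟨⟩

module Monomials (E : CommutativeRing 0ℓ 0ℓ) (isField : FieldDefs.IsField E)
                 (K : Pred (CommutativeRing.Carrier E) 0ℓ) (isSubfield : FieldDefs.IsSubfield E K) where
  open CommutativeRing E hiding (zero) renaming (Carrier to F)
  open FieldDefs E
  open Span E isField K isSubfield
  open import Algebra.Properties.CommutativeSemigroup *-commutativeSemigroup using (x∙yz≈y∙xz)

  monomials : ∀ k r → Vector F k → Vector F (multichoose k r)
  monomials k       zero    s = λ _ → 1#
  monomials zero    (suc r) s = λ ()
  monomials (suc k) (suc r) s = monomials k (suc r) (tail s) ++ ((head s *_) ∘ monomials (suc k) r s)

  *-monomial-∈⟨monomials⟩ : ∀ k r (s : Vector F k) l i → s l * monomials k r s i ∈⟨ monomials k (suc r) s ⟩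
  *-monomial-∈⟨monomials⟩ (suc k) zero    s zero    i = ∈⟨++ʳ⟩ (monomials k 1 (tail s)) (generator-∈⟨⟩ zero)
  *-monomial-∈⟨monomials⟩ (suc k) zero    s (suc l) i =
    ∈⟨++ˡ⟩ ((head s *_) ∘ monomials (suc k) 0 s) (*-monomial-∈⟨monomials⟩ k zero (tail s) l zero)
  *-monomial-∈⟨monomials⟩ (suc k) (suc r) s zero    i =
    ∈⟨++ʳ⟩ (monomials k (suc (suc r)) (tail s)) (generator-∈⟨⟩ i)
  *-monomial-∈⟨monomials⟩ (suc k) (suc r) s (suc l) =
    ++-all (λ y → s (suc l) * y ∈⟨ monomials (suc k) (suc (suc r)) s ⟩)
      (λ t → ∈⟨++ˡ⟩ ((head s *_) ∘ monomials (suc k) (suc r) s) (*-monomial-∈⟨monomials⟩ k (suc r) (tail s) l t))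
      (λ t → ∈⟨++ʳ⟩ (monomials k (suc (suc r)) (tail s))
               (∈⟨⟩-resp (x∙yz≈y∙xz (head s) (s (suc l)) (monomials (suc k) r s t))
                         (*-∈⟨*⟩ (head s) (*-monomial-∈⟨monomials⟩ (suc k) r s (suc l) t))))

  prodF-∈⟨monomials⟩ : ∀ k r (s : Vector F k) (a : Vector F r) → (∀ i → a i ∈⟨ s ⟩) →
                       prodF a ∈⟨ monomials k r s ⟩
  prodF-∈⟨monomials⟩ k zero    s a a∈ = generator-∈⟨⟩ zero
  prodF-∈⟨monomials⟩ k (suc r) s a a∈ =
    *-∈⟨⟩-bilinear (*-monomial-∈⟨monomials⟩ k r s) (a∈ zero) (prodF-∈⟨monomials⟩ k r s (tail a) (a∈ ∘ suc))

module Sidon (E : CommutativeRing 0ℓ 0ℓ) (isField : FieldDefs.IsField E)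
             (K : Pred (CommutativeRing.Carrier E) 0ℓ) (isSubfield : FieldDefs.IsSubfield E K)
             (_≟0 : ∀ x → Dec (CommutativeRing._≈_ E x (CommutativeRing.0# E)))
             {k : ℕ} (V : Pred (CommutativeRing.Carrier E) 0ℓ) (basis : FieldDefs.HasDim E K V (suc k)) where
  open CommutativeRing E hiding (zero) renaming (Carrier to F)
  open FieldDefs E
  open Dimension E isField K isSubfield _≟0
  open Monomials E isField K isSubfield
  open import Relation.Binary.Reasoning.Setoid setoid
  open import Algebra.Solver.Ring.NaturalCoefficients.Default commutativeSemiring
  open import Algebra.Properties.Ring ring using (-‿distribʳ-*)

  v : Vector F (suc k)
  v = proj₁ basis

  V-v : ∀ i → V (v i)
  V-v = proj₁ (proj₂ basis)

  spanning : ∀ x → V x → LinComb K v x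
  spanning = proj₂ (proj₂ (proj₂ basis))

  Spans : Vector F (suc k) → Set
  Spans s = (∀ i → V (s i)) × (∀ {x} → V x → x ∈⟨ s ⟩)

  Pow-∈⟨monomials⟩ : ∀ {r x} {s : Vector F (suc k)} → Spans s → Pow K V r x → x ∈⟨ monomials (suc k) r s ⟩
  Pow-∈⟨monomials⟩ {r} {s = s} (_ , spans) (_ , c , a , Kc , Va , x≈Σ) =
    ∈⟨⟩-resp (sym x≈Σ)
      (sumF-∈⟨⟩ _ (λ j → *-∈⟨⟩ (Kc j) (prodF-∈⟨monomials⟩ (suc k) r s (a j) (spans ∘ Va j))))

  MonomialsIndependent : ℕ → Set
  MonomialsIndependent r = ∀ s → Spans s → LinIndep K (monomials (suc k) r s)

  monomialsIndependent : ∀ r → HasDim K (Pow K V r) (multichoose (suc k) r) → MonomialsIndependent r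
  monomialsIndependent r (b , b∈Pow , indep , _) s spans =
    LinIndep-spanning indep (λ i → Pow-∈⟨monomials⟩ spans (b∈Pow i))

  monomialsIndependent-pred : ∀ r → MonomialsIndependent (suc r) → MonomialsIndependent r
  monomialsIndependent-pred r indep s spans =
    LinIndep-*⁻¹ (head s) (LinIndep-++ʳ {u = monomials k (suc r) (tail s)} (indep s spans))

  spansStartingWith : ∀ {a} → V a → ¬ a ≈ 0# → ∃[ f ] Spans (a ∷ f)
  spansStartingWith {a} Va a≉0 with spanning a Va
  ... | c , Kc , a≈Σ with someNonzero? c
  ...   | no none =
    ⊥-elim (a≉0 (trans a≈Σ (sumF-zero {f = λ j → c j * v j} (λ j → trans (*-congʳ (allZero none j)) (zeroˡ _)))))
  ...   | yes (j , cⱼ≉0) = removeAt v j , V-s , λ Vx → ∈⟨⟩-mono v⊆s (LinComb⇒∈⟨⟩ (spanning _ Vx))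
    where
    V-s : ∀ i → V ((a ∷ removeAt v j) i)
    V-s zero    = Va
    V-s (suc t) = V-v (punchIn j t)
    v⊆s : ∀ i → v i ∈⟨ a ∷ removeAt v j ⟩
    v⊆s = ∈⟨⟩-exchange c Kc a≈Σ cⱼ≉0 (generator-∈⟨⟩ zero) (generator-∈⟨⟩ ∘ suc)

  prodF-expandHead : ∀ r (s : Vector F (suc k)) {b : Vector F (suc r)} (hb : ∀ j → HeadSplit s (b j)) →
                     ∃[ w ] w ∈⟨ monomials (suc k) r s ⟩
                          × prodF b ≈ prodF (λ j → HeadSplit.rest (hb j)) + head s * w
  prodF-expandHead zero s {b} hb = B.coeff zero , β∈ , (begin
    b zero * 1#                      ≈⟨ *-congʳ (B.split zero) ⟩
    (B.coeff zero * s zero + B.rest zero) * 1#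
      ≈⟨ solve 3 (λ β s₀ ρ → (β :* s₀ :+ ρ) :* con 1 := ρ :* con 1 :+ s₀ :* β)
               refl (B.coeff zero) (s zero) (B.rest zero) ⟩
    B.rest zero * 1# + s zero * B.coeff zero ∎)
    where
    module B (j : Fin 1) = HeadSplit (hb j)
    β∈ : B.coeff zero ∈⟨ monomials (suc k) 0 s ⟩
    β∈ = ∈⟨⟩-resp (*-identityʳ _) (*-∈⟨⟩ (B.K-coeff zero) (generator-∈⟨⟩ zero))
  prodF-expandHead (suc r) s {b} hb = w , w∈ , (begin
    b zero * prodF (tail b)          ≈⟨ *-cong (B.split zero) expansion ⟩
    (β * s zero + ρ) * (P + s zero * w₁)
      ≈⟨ solve 5 (λ β s₀ ρ P w₁ → (β :* s₀ :+ ρ) :* (P :+ s₀ :* w₁)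
                                 := ρ :* P :+ s₀ :* (β :* P :+ β :* (s₀ :* w₁) :+ ρ :* w₁))
               refl β (s zero) ρ P w₁ ⟩
    ρ * P + s zero * w               ∎)
    where
    module B (j : Fin (suc (suc r))) = HeadSplit (hb j)
    β ρ P w₁ w : F
    β = B.coeff zero
    ρ = B.rest zero
    P = prodF (B.rest ∘ suc)
    w₁ = proj₁ (prodF-expandHead r s (hb ∘ suc))
    w = β * P + β * (s zero * w₁) + ρ * w₁
    w₁∈ : w₁ ∈⟨ monomials (suc k) r s ⟩
    w₁∈ = proj₁ (proj₂ (prodF-expandHead r s (hb ∘ suc)))
    expansion : prodF (tail b) ≈ P + s zero * w₁
    expansion = proj₂ (proj₂ (prodF-expandHead r s (hb ∘ suc)))
    ∈⟨s⟩ : ∀ {x} → x ∈⟨ tail s ⟩ → x ∈⟨ s ⟩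
    ∈⟨s⟩ = ∈⟨⟩-mono (generator-∈⟨⟩ ∘ suc)
    *-w₁∈ : ∀ {x} → x ∈⟨ s ⟩ → x * w₁ ∈⟨ monomials (suc k) (suc r) s ⟩
    *-w₁∈ x∈ = *-∈⟨⟩-bilinear (*-monomial-∈⟨monomials⟩ (suc k) r s) x∈ w₁∈
    w∈ : w ∈⟨ monomials (suc k) (suc r) s ⟩
    w∈ = +-∈⟨⟩ (+-∈⟨⟩ (*-∈⟨⟩ (B.K-coeff zero) (prodF-∈⟨monomials⟩ (suc k) (suc r) s _ (∈⟨s⟩ ∘ B.rest∈ ∘ suc)))
                      (*-∈⟨⟩ (B.K-coeff zero) (*-w₁∈ (generator-∈⟨⟩ zero))))
                (*-w₁∈ (∈⟨s⟩ (B.rest∈ zero)))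

  -- γ ∏ ρⱼ and s₀ (γ w - U) lie in complementary blocks of the independent degree-(r+1) monomials
  -- (those avoiding s₀ and those divisible by s₀) and sum to 0, so ∏ ρⱼ = 0.
  factorOnHeadLine : ∀ r → MonomialsIndependent (suc r) → ∀ {s U γ} (b : Vector F (suc r)) → Spans s →
                     U ∈⟨ monomials (suc k) r s ⟩ → (∀ j → V (b j)) → K γ → ¬ γ ≈ 0# →
                     head s * U ≈ γ * prodF b → ∃[ j ] ∃[ β ] K β × b j ≈ β * head s
  factorOnHeadLine r indep {s} {U} {γ} b spans U∈ Vb Kγ γ≉0 s₀U≈γΠb = j , B.coeff j , B.K-coeff j , (begin
    b j                        ≈⟨ B.split j ⟩
    B.coeff j * s zero + B.rest j ≈⟨ +-congˡ ρⱼ≈0 ⟩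
    B.coeff j * s zero + 0#    ≈⟨ +-identityʳ _ ⟩
    B.coeff j * s zero         ∎)
    where
    hb : ∀ j → HeadSplit s (b j)
    hb j = headSplit (proj₂ spans (Vb j))
    module B j = HeadSplit (hb j)
    w : F
    w = proj₁ (prodF-expandHead r s hb)
    w∈ : w ∈⟨ monomials (suc k) r s ⟩
    w∈ = proj₁ (proj₂ (prodF-expandHead r s hb))
    Πb≈ : prodF b ≈ prodF B.rest + s zero * w
    Πb≈ = proj₂ (proj₂ (prodF-expandHead r s hb))
    avoiding : γ * prodF B.rest ∈⟨ monomials k (suc r) (tail s) ⟩
    avoiding = *-∈⟨⟩ Kγ (prodF-∈⟨monomials⟩ k (suc r) (tail s) B.rest B.rest∈)
    divisible : s zero * (γ * w + - U) ∈⟨ (head s *_) ∘ monomials (suc k) r s ⟩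
    divisible = *-∈⟨*⟩ (s zero) (+-∈⟨⟩ (*-∈⟨⟩ Kγ w∈) (-‿∈⟨⟩ U∈))
    sum≈0 : γ * prodF B.rest + s zero * (γ * w + - U) ≈ 0#
    sum≈0 = begin
      γ * prodF B.rest + s zero * (γ * w + - U)
        ≈⟨ solve 5 (λ γ P s₀ w Ū → γ :* P :+ s₀ :* (γ :* w :+ Ū) := γ :* (P :+ s₀ :* w) :+ s₀ :* Ū)
                 refl γ (prodF B.rest) (s zero) w (- U) ⟩
      γ * (prodF B.rest + s zero * w) + s zero * - U ≈⟨ +-cong (*-congˡ Πb≈) (-‿distribʳ-* _ _) ⟨
      γ * prodF b + - (s zero * U)                   ≈⟨ +-congʳ s₀U≈γΠb ⟨
      s zero * U + - (s zero * U)                    ≈⟨ -‿inverseʳ _ ⟩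
      0#                                             ∎
    Πρ≈0 : prodF B.rest ≈ 0#
    Πρ≈0 = *-cancelˡ γ≉0 (trans (LinIndep-++⇒≈0 (indep s spans) avoiding divisible sum≈0) (sym (zeroʳ γ)))
    j : Fin (suc r)
    j = proj₁ (prodF≈0⇒ B.rest Πρ≈0)
    ρⱼ≈0 : B.rest j ≈ 0#
    ρⱼ≈0 = proj₂ (prodF≈0⇒ B.rest Πρ≈0)

  matchLines : ∀ r → MonomialsIndependent r → (a b : Vector F r) →
               (∀ i → V (a i) × ¬ a i ≈ 0#) → (∀ i → V (b i) × ¬ b i ≈ 0#) →
               ∀ {γ} → K γ → ¬ γ ≈ 0# → prodF a ≈ γ * prodF b →
               Σ (Permutation′ r) λ σ → ∀ i → SameLine K (a i) (b (σ ⟨$⟩ʳ i))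
  matchLines zero    _     a b _  _  _  _   _      = idₚ , λ ()
  matchLines (suc r) indep a b Va Vb {γ} Kγ γ≉0 Πa≈γΠb =
    extend (factorOnHeadLine r indep b spans tail∈ (proj₁ ∘ Vb) Kγ γ≉0 Πa≈γΠb)
    where
    a₀≉0 : ¬ a zero ≈ 0#
    a₀≉0 = proj₂ (Va zero)
    s : Vector F (suc k)
    s = a zero ∷ proj₁ (spansStartingWith (proj₁ (Va zero)) a₀≉0)
    spans : Spans s
    spans = proj₂ (spansStartingWith (proj₁ (Va zero)) a₀≉0)
    tail∈ : prodF (tail a) ∈⟨ monomials (suc k) r s ⟩
    tail∈ = prodF-∈⟨monomials⟩ (suc k) r s (tail a) (proj₂ spans ∘ proj₁ ∘ Va ∘ suc)
    extend : ∃[ j ] ∃[ β ] K β × b j ≈ β * a zero →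
             Σ (Permutation′ (suc r)) λ σ → ∀ i → SameLine K (a i) (b (σ ⟨$⟩ʳ i))
    extend (j , β , Kβ , bⱼ≈βa₀) = insert zero j τ , lines
      where
      β≉0 : ¬ β ≈ 0#
      β≉0 β≈0 = proj₂ (Vb j) (trans bⱼ≈βa₀ (trans (*-congʳ β≈0) (zeroˡ _)))
      matching : Σ (Permutation′ r) λ τ → ∀ i → SameLine K (a (suc i)) (b (punchIn j (τ ⟨$⟩ʳ i)))
      matching = matchLines r (monomialsIndependent-pred r indep) (tail a) (removeAt b j) (Va ∘ suc) (Vb ∘ punchIn j)
                            (Sub.mulK Kγ Kβ) (*-≉0 γ≉0 β≉0) (prodF-cancelHead a b j a₀≉0 bⱼ≈βa₀ Πa≈γΠb)
      τ : Permutation′ r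
      τ = proj₁ matching
      lines : ∀ i → SameLine K (a i) (b (insert zero j τ ⟨$⟩ʳ i))
      lines zero    = SameLine-* Kβ β≉0 bⱼ≈βa₀
      lines (suc i) = ≡.subst (λ l → SameLine K (a (suc i)) (b l)) (≡.sym (insert-punchIn zero j τ i))
                              (proj₂ matching i)

open import Data.Nat using (_+_; _∸_)

mainTheorem4 : (q n k r : ℕ) (E : CommutativeRing 0ℓ 0ℓ)
    → FieldDefs.IsField E
    → (K : Pred (CommutativeRing.Carrier E) 0ℓ) → FieldDefs.IsSubfield E K
    → FieldDefs.HasCard E K q
    → FieldDefs.HasDim E K (FieldDefs.Whole E) n
    → 2 ≤ r → 1 ≤ k → k < n
    → (V : Pred (CommutativeRing.Carrier E) 0ℓ) → FieldDefs.IsSubspace E K V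
    → FieldDefs.HasDim E K V k
    → FieldDefs.HasDim E K (FieldDefs.Pow E K V r) ((k + r ∸ 1) C r)
    → FieldDefs.IsRSidon E K V r
mainTheorem4 q n zero    r E isField K isSubfield card whole _ () _ V _ _ _
mainTheorem4 q n (suc k) r E isField K isSubfield card whole _ _ _ V _ basisV dimPow a b Va Vb Πa≈Πb =
  matchLines r (monomialsIndependent r dimPow′) a b Va Vb
             (IsSubfield.oneK isSubfield) (IsField.nontrivial isField) (trans Πa≈Πb (sym (*-identityˡ _)))
  where
  open CommutativeRing E using (trans; sym; *-identityˡ)
  open FieldDefs E
  open Sidon E isField K isSubfield (Span.≈0-dec E isField K isSubfield card whole) V basisV
  dimPow′ : HasDim K (Pow K V r) (multichoose (suc k) r)
  dimPow′ = ≡.subst (HasDim K (Pow K V r)) (≡.sym (multichoose≡binomial (suc k) r)) dimPow
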